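{- For each $n\in\mathbb{N}$ with $n\ge1$, the instruction sequence $\mathrm{TSTNZ}_n={;}_{i=1}^{n}\big(+\mathtt{in}{:}i.\mathtt{get};\mathtt{out}.\mathtt{set}{:}1\big);!$ computes $\mathrm{tstnz}_n$.
   Context: Basic instructions: $\mathtt{in}{:}i.\mathtt{get}$ ($i\ge1$), $\mathtt{out}.\mathtt{set}{:}b$ ($b\in\{0,1\}$), $\mathtt{aux}{:}i.\mathtt{get}$ ($i\ge1$), $\mathtt{aux}{:}i.\mathtt{set}{:}b$ ($i\ge1$, $b\in\{0,1\}$). The part before the dot names a Boolean register ($\mathtt{in}{:}i$ input, $\mathtt{out}$ output, $\mathtt{aux}{:}i$ auxiliary); $\mathtt{get}$ changes nothing and replies the content, $\mathtt{set}{:}b$ makes the content $b$ and replies $b$. Primitive instructions: for each basic instruction $a$, plain $a$, positive test $+a$, negative test $-a$; forward jumps $\#l$ ($l\in\mathbb{N}$); termination $!$. Instruction sequences are finite sequences $u_1;\dots;u_k$ of primitive instructions; ${;}_{i=p}^{q}P_i$ denotes the concatenation $P_p;\dots;P_q$. Execution starts at $u_1$: plain $a$ executes $a$ and proceeds with the next instruction; $+a$ executes $a$ and proceeds with the next instruction if the reply is $1$, otherwise skips the next one and proceeds with the one after it; $-a$ likewise with replies reversed; $\#l$ proceeds with the $l$-th next instruction; $!$ terminates. If $l=0$ or there is no instruction to proceed with, execution never terminates. For $f:\{0,1\}^n\to\{0,1\}$, $X$ computes $f$ if there is $k$ such that for all $b_1,\dots,b_n$, executing $X$ with $\mathtt{in}{:}i$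 initially $b_i$, $\mathtt{out}$ and $\mathtt{aux}{:}1,\dots,\mathtt{aux}{:}k$ initially $0$ terminates with final content of $\mathtt{out}$ equal to $f(b_1,\dots,b_n)$. $\mathrm{tstnz}_n(b_1,\dots,b_n)=1$ iff some $b_i=1$. -}

module Defs where

open import Data.Nat using (ℕ; zero; suc; _+_; _≤_; _<_)
open import Data.Bool using (Bool; true; false; _∨_)
open import Data.List using (List; []; _∷_; _++_; length; lookup)
open import Data.Fin using (Fin)
open import Data.Vec as Vec using (Vec)
open import Data.Product using (Σ; _×_; _,_; ∃)
open import Relation.Binary.PropositionalEquality using (_≡_)
open import Relation.Nullary using (yes; no)
open import Data.Nat using (_≟_; _<?_)

data Basic : Set where
  inGet  : ℕ → Basic
  outSet : Bool → Basic
  auxGet : ℕ → Basic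
  auxSet : ℕ → Bool → Basic

data Prim : Set where
  plain : Basic → Prim
  ptest : Basic → Prim
  ntest : Basic → Prim
  jump  : ℕ → Prim
  halt  : Prim

InstrSeq : Set
InstrSeq = List Prim

concatFrom : ℕ → (ℕ → InstrSeq) → ℕ → InstrSeq
concatFrom i P zero    = []
concatFrom i P (suc m) = P i ++ concatFrom (suc i) P m

seqConcat : (n : ℕ) → (ℕ → InstrSeq) → InstrSeq
seqConcat n P = concatFrom 1 P n

record State : Set where
  constructor st
  field
    inp : ℕ → Bool
    out : Bool
    aux : ℕ → Bool
open State

updAux : (ℕ → Bool) → ℕ → Bool → (ℕ → Bool)
updAux f i b j with i ≟ j
... | yes _ = b
... | no _  = f j

exec : Basic → State → Bool × State
exec (inGet i)    s = inp s i , s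
exec (outSet b)   s = b , st (inp s) b (aux s)
exec (auxGet i)   s = aux s i , s
exec (auxSet i b) s = b , st (inp s) (out s) (updAux (aux s) i b)

-- Proceeding to a
-- position outside X (or #0 which loops forever) never yields Halts.
data Halts (X : InstrSeq) : ℕ → State → State → Set where
  h-halt  : ∀ {pc s} (p : pc < length X) →
            lookup X (Data.Fin.fromℕ< p) ≡ halt → Halts X pc s s
  h-plain : ∀ {pc s s' a} (p : pc < length X) →
            lookup X (Data.Fin.fromℕ< p) ≡ plain a →
            Halts X (suc pc) (Data.Product.proj₂ (exec a s)) s' →
            Halts X pc s s'
  h-ptest1 : ∀ {pc s s' a} (p : pc < length X) →
            lookup X (Data.Fin.fromℕ< p) ≡ ptest a →
            Data.Product.proj₁ (exec a s) ≡ true →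
            Halts X (suc pc) (Data.Product.proj₂ (exec a s)) s' →
            Halts X pc s s'
  h-ptest0 : ∀ {pc s s' a} (p : pc < length X) →
            lookup X (Data.Fin.fromℕ< p) ≡ ptest a →
            Data.Product.proj₁ (exec a s) ≡ false →
            Halts X (suc (suc pc)) (Data.Product.proj₂ (exec a s)) s' →
            Halts X pc s s'
  h-ntest0 : ∀ {pc s s' a} (p : pc < length X) →
            lookup X (Data.Fin.fromℕ< p) ≡ ntest a →
            Data.Product.proj₁ (exec a s) ≡ false →
            Halts X (suc pc) (Data.Product.proj₂ (exec a s)) s' →
            Halts X pc s s'
  h-ntest1 : ∀ {pc s s' a} (p : pc < length X) →
            lookup X (Data.Fin.fromℕ< p) ≡ ntest a →
            Data.Product.proj₁ (exec a s) ≡ true →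
            Halts X (suc (suc pc)) (Data.Product.proj₂ (exec a s)) s' →
            Halts X pc s s'
  h-jump  : ∀ {pc s s' l} (p : pc < length X) →
            lookup X (Data.Fin.fromℕ< p) ≡ jump l →
            1 ≤ l →
            Halts X (pc + l) s s' →
            Halts X pc s s'

-- Initial state for inputs b_1..b_n: in:i holds b_i for 1 ≤ i ≤ n
-- (registers in:i with i = 0 or i > n do not exist; they are given
-- content 0 here), out and all aux registers hold 0.
inputFun : ∀ {n} → Vec Bool n → ℕ → Bool
inputFun {n} bs zero    = false
inputFun {n} bs (suc i) with i <? n
... | yes p = Vec.lookup bs (Data.Fin.fromℕ< p)
... | no _  = false

initState : ∀ {n} → Vec Bool n → State
initState bs = st (inputFun bs) false (λ _ → false)

-- X computes f : {0,1}^n → {0,1}: executing X from its first instruction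
-- on every input terminates with out = f(b_1,...,b_n).
-- (Aux registers all start at 0, which covers "aux:1..aux:k start at 0"
-- for any k.)
Computes : (n : ℕ) → InstrSeq → (Vec Bool n → Bool) → Set
Computes n X f = ∀ (bs : Vec Bool n) →
  Σ State λ s' → Halts X 0 (initState bs) s' × out s' ≡ f bs

tstnz : (n : ℕ) → Vec Bool n → Bool
tstnz n bs = Vec.foldr _ _∨_ false bs

TSTNZ : ℕ → InstrSeq
TSTNZ n = seqConcat n (λ i → ptest (inGet i) ∷ plain (outSet true) ∷ []) ++ (halt ∷ [])

-- Scanning in:1, …, in:n in turn, the block for in:i sets out to 1 exactly
-- when in:i holds 1 and otherwise jumps over that assignment; so after the
-- blocks for in:i, …, in:(i+m-1) the output holds its old value or'ed with
-- those inputs. Induction on the number of remaining blocks, each run as a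
-- suffix of the whole sequence, gives the claim.
module Submission where

open import Defs
open import Data.Nat using (ℕ; _≥_; zero; suc; _+_; _<_; s≤s; z≤n; _<?_)
open import Data.Nat.Properties using (≤-irrelevant)
open import Data.Bool using (Bool; true; false; _∨_)
open import Data.Bool.Properties using (∨-identityʳ; ∨-zeroʳ)
open import Data.List using ([]; _∷_; _++_; length)
open import Data.Fin using (fromℕ<)
open import Data.Vec as Vec using (Vec)
open import Data.Product using (Σ; _×_; _,_)
open import Relation.Nullary using (yes; no; contradiction)
open import Relation.Binary.PropositionalEquality using (_≡_; refl; sym; trans; cong; cong₂)

Halts-∷ : ∀ {x X pc s s'} → Halts X pc s s' → Halts (x ∷ X) (suc pc) s s'
Halts-∷ (h-halt p q) = h-halt (s≤s p) q
Halts-∷ (h-plain p q h) = h-plain (s≤s p) q (Halts-∷ h)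
Halts-∷ (h-ptest1 p q r h) = h-ptest1 (s≤s p) q r (Halts-∷ h)
Halts-∷ (h-ptest0 p q r h) = h-ptest0 (s≤s p) q r (Halts-∷ h)
Halts-∷ (h-ntest0 p q r h) = h-ntest0 (s≤s p) q r (Halts-∷ h)
Halts-∷ (h-ntest1 p q r h) = h-ntest1 (s≤s p) q r (Halts-∷ h)
Halts-∷ (h-jump p q l≥1 h) = h-jump (s≤s p) q l≥1 (Halts-∷ h)

Halts-++ʳ : ∀ xs {ys pc s s'} → Halts ys pc s s' → Halts (xs ++ ys) (length xs + pc) s s'
Halts-++ʳ []       h = h
Halts-++ʳ (x ∷ xs) h = Halts-∷ (Halts-++ʳ xs h)

anyFrom : (ℕ → Bool) → ℕ → ℕ → Bool
anyFrom f i zero    = false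
anyFrom f i (suc m) = f i ∨ anyFrom f (suc i) m

TestBlock : ℕ → InstrSeq
TestBlock i = ptest (inGet i) ∷ plain (outSet true) ∷ []

TestBlocks-halt : ∀ i m f o a →
  Σ State λ s' → Halts (concatFrom i TestBlock m ++ halt ∷ []) 0 (st f o a) s'
               × State.out s' ≡ o ∨ anyFrom f i m
TestBlocks-halt i zero    f o a = st f o a , h-halt (s≤s z≤n) refl , sym (∨-identityʳ o)
TestBlocks-halt i (suc m) f o a with f i in fi
... | true  =
  let s' , h , out≡ = TestBlocks-halt (suc i) m f true a
  in  s' , h-ptest1 (s≤s z≤n) refl fi (h-plain (s≤s (s≤s z≤n)) refl (Halts-++ʳ (TestBlock i) h))
         , trans out≡ (sym (∨-zeroʳ o))
... | false =
  let s' , h , out≡ = TestBlocks-halt (suc i) m f o a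
  in  s' , h-ptest0 (s≤s z≤n) refl fi (Halts-++ʳ (TestBlock i) h) , out≡

inputFun-∷ : ∀ {n} x (bs : Vec Bool n) i → inputFun (x Vec.∷ bs) (suc (suc i)) ≡ inputFun bs (suc i)
inputFun-∷ {n} x bs i with suc i <? suc n | i <? n
... | yes (s≤s p) | yes q = cong (λ r → Vec.lookup bs (fromℕ< r)) (≤-irrelevant p q)
... | yes (s≤s p) | no ¬q = contradiction p ¬q
... | no ¬p       | yes q = contradiction (s≤s q) ¬p
... | no _        | no _  = refl

anyFrom-shift : ∀ f g i m → (∀ j → f (suc (suc j)) ≡ g (suc j)) →
  anyFrom f (suc (suc i)) m ≡ anyFrom g (suc i) m
anyFrom-shift f g i zero    f≗g = refl
anyFrom-shift f g i (suc m) f≗g = cong₂ _∨_ (f≗g i) (anyFrom-shift f g (suc i) m f≗g)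

anyFrom-inputFun : ∀ n (bs : Vec Bool n) → anyFrom (inputFun bs) 1 n ≡ tstnz n bs
anyFrom-inputFun zero    Vec.[]       = refl
anyFrom-inputFun (suc n) (x Vec.∷ bs) =
  cong (x ∨_) (trans (anyFrom-shift _ _ 0 n (inputFun-∷ x bs)) (anyFrom-inputFun n bs))

proposition1 : (n : ℕ) → n ≥ 1 → Computes n (TSTNZ n) (tstnz n)
proposition1 n _ bs =
  let s' , h , out≡ = TestBlocks-halt 1 n (inputFun bs) false (λ _ → false)
  in  s' , h , trans out≡ (anyFrom-inputFun n bs)
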